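{- Let $G$ and $H$ be finite digraphs and for each $x\in V(G)$ let $L(x)\subseteq V(H)$ be a list. Suppose $h$ is a Maltsev homomorphism of $G\times H^3$ to $H$ consistent with $L$. Let $X$ be an oriented path in $G$, and let $B,C,D$ be three walks in $L(X)$, each congruent to $X$, where $B$ is from $a$ to $c$, $C$ is from $b$ to $c$, and $D$ is from $b$ to $d$. Then there exists a walk $E$ from $a$ to $d$ in $L(X)$ that is congruent with $X$.
   Context: For a digraph $D$, $V(D)$ is its vertex set and $A(D)$ its arc set; $uv$ denotes the arc $(u,v)$. An oriented walk (path) is a walk (path) whose edges are each oriented, i.e. a sequence $x_0,x_1,\dots,x_n$ where for each $i$ either $x_ix_{i+1}$ is an arc (forward) or $x_{i+1}x_i$ is an arc (backward). Two oriented walks are congruent if they have the same length and the same pattern of forward and backward arcs. For an oriented path $X=x_0,\dots,x_n$ in $G$, a walk $B=b_0,\dots,b_n$ in $H$ congruent to $X$ is in $L(X)$ if $b_i\in L(x_i)$ for all $i$. A function $h$ assigning to each $x\in V(G)$ and $a_1,a_2,a_3\in L(x)$ a vertex $h(x;a_1,a_2,a_3)$ is a homomorphism of $G\times H^3$ to $H$ consistent with $L$ if $h(x;a_1,a_2,a_3)\in L(x)$ always, and whenever $xy\in A(G)$, $a_i\in L(x)$, $b_i\in L(y)$ and $a_ib_i\in A(H)$ for $i=1,2,3$, then $h(x;a_1,a_2,a_3)h(y;b_1,b_2,b_3)\in A(H)$. It is Maltsev if $h(x;a,b,b)=h(x;b,b,a)=a$ for all $x\in V(G)$ and all $a,b\in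 L(x)$. -}

module Defs where

open import Data.Nat using (ℕ; suc)
open import Data.Fin using (Fin)
open import Data.Bool using (Bool; true)
open import Data.Vec using (Vec; []; _∷_; lookup; head; last)
open import Data.Product using (_×_)
open import Data.Unit using (⊤)
open import Relation.Binary.PropositionalEquality using (_≡_; _≢_)

record Digraph : Set where
  field
    size : ℕ
    arc  : Fin size → Fin size → Bool

open Digraph public

V : Digraph → Set
V D = Fin (size D)

Arc : (D : Digraph) → V D → V D → Set
Arc D u v = arc D u v ≡ true

data Dir : Set where
  fwd bwd : Dir

Step : (D : Digraph) → Dir → V D → V D → Set
Step D fwd u v = Arc D u v
Step D bwd u v = Arc D v u

-- Walks with the same pattern are congruent.
IsWalk : (D : Digraph) {n : ℕ} → Vec Dir n → Vec (V D) (suc n) → Set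
IsWalk D []       (x ∷ [])     = ⊤
IsWalk D (p ∷ ps) (x ∷ y ∷ xs) = Step D p x y × IsWalk D ps (y ∷ xs)

Distinct : {A : Set} {m : ℕ} → Vec A m → Set
Distinct {m = m} xs = (i j : Fin m) → i ≢ j → lookup xs i ≢ lookup xs j

IsOrientedPath : (D : Digraph) {n : ℕ} → Vec Dir n → Vec (V D) (suc n) → Set
IsOrientedPath D ps xs = IsWalk D ps xs × Distinct xs

Lists : Digraph → Digraph → Set
Lists G H = V G → V H → Bool

InList : (G H : Digraph) → Lists G H → V G → V H → Set
InList G H L x a = L x a ≡ true

InLists : (G H : Digraph) (L : Lists G H) {m : ℕ} → Vec (V G) m → Vec (V H) m → Set
InLists G H L {m} xs bs = (i : Fin m) → InList G H L (lookup xs i) (lookup bs i)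

Ternary : (G H : Digraph) → Lists G H → Set
Ternary G H L = (x : V G) (a₁ a₂ a₃ : V H) →
  InList G H L x a₁ → InList G H L x a₂ → InList G H L x a₃ → V H

IsConsistentHom : (G H : Digraph) (L : Lists G H) → Ternary G H L → Set
IsConsistentHom G H L h =
  ((x : V G) (a₁ a₂ a₃ : V H) (p₁ : InList G H L x a₁) (p₂ : InList G H L x a₂) (p₃ : InList G H L x a₃) →
     InList G H L x (h x a₁ a₂ a₃ p₁ p₂ p₃))
  ×
  ((x y : V G) (a₁ a₂ a₃ b₁ b₂ b₃ : V H) →
   (p₁ : InList G H L x a₁) (p₂ : InList G H L x a₂) (p₃ : InList G H L x a₃) →
   (q₁ : InList G H L y b₁) (q₂ : InList G H L y b₂) (q₃ : InList G H L y b₃) →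
   Arc G x y → Arc H a₁ b₁ → Arc H a₂ b₂ → Arc H a₃ b₃ →
   Arc H (h x a₁ a₂ a₃ p₁ p₂ p₃) (h y b₁ b₂ b₃ q₁ q₂ q₃))

IsMaltsev : (G H : Digraph) (L : Lists G H) → Ternary G H L → Set
IsMaltsev G H L h =
  (x : V G) (a b : V H) (pa : InList G H L x a) (pb : InList G H L x b) →
    (h x a b b pa pb pb ≡ a) × (h x b b a pb pb pa ≡ a)

WalkInL : (G H : Digraph) (L : Lists G H) {n : ℕ} →
  Vec Dir n → Vec (V G) (suc n) → Vec (V H) (suc n) → Set
WalkInL G H L ps xs bs = IsWalk H ps bs × InLists G H L xs bs

-- Apply h coordinatewise: E = h(X; B, C, D).  Since h is a homomorphism of
-- G × H³ to H consistent with L, E is a walk in L(X) congruent to X.  Its first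
-- vertex is h(x₀; a, b, b) = a and its last vertex is h(xₙ; c, c, d) = d by the
-- two Maltsev identities.
module Submission where

open import Defs
open import Data.Nat using (ℕ; suc)
open import Data.Fin using (zero; suc)
open import Data.Vec using (Vec; head; last; []; _∷_)
open import Data.Product using (Σ; _×_; _,_; proj₁; proj₂)
open import Data.Unit using (tt)
open import Data.Bool.Properties using (_≟_)
open import Function using (_∘_)
open import Relation.Binary.PropositionalEquality using (_≡_; refl; sym; trans)
open import Axiom.UniquenessOfIdentityProofs using (module Decidable⇒UIP)

module _ {G H : Digraph} {L : Lists G H} where

  InList-irrelevant : ∀ {x a} (p q : InList G H L x a) → p ≡ q
  InList-irrelevant = Decidable⇒UIP.≡-irrelevant _≟_

  InLists-tail : ∀ {m x a} {xs : Vec (V G) m} {as : Vec (V H) m} →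
    InLists G H L (x ∷ xs) (a ∷ as) → InLists G H L xs as
  InLists-tail p = p ∘ suc

  module _ (h : Ternary G H L) where

    pointwise : ∀ {m} (xs : Vec (V G) m) (B C D : Vec (V H) m) →
      InLists G H L xs B → InLists G H L xs C → InLists G H L xs D → Vec (V H) m
    pointwise []       []      []      []      _  _  _  = []
    pointwise (x ∷ xs) (b ∷ B) (c ∷ C) (d ∷ D) pB pC pD =
      h x b c d (pB zero) (pC zero) (pD zero) ∷
      pointwise xs B C D (InLists-tail pB) (InLists-tail pC) (InLists-tail pD)

    module _ (hom : IsConsistentHom G H L h) where

      pointwise-InLists : ∀ {m} (xs : Vec (V G) m) (B C D : Vec (V H) m)
        (pB : InLists G H L xs B) (pC : InLists G H L xs C) (pD : InLists G H L xs D) →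
        InLists G H L xs (pointwise xs B C D pB pC pD)
      pointwise-InLists (x ∷ xs) (b ∷ B) (c ∷ C) (d ∷ D) pB pC pD zero =
        proj₁ hom x b c d _ _ _
      pointwise-InLists (x ∷ xs) (b ∷ B) (c ∷ C) (d ∷ D) pB pC pD (suc i) =
        pointwise-InLists xs B C D _ _ _ i

      Step-preserved : ∀ δ {x y a₁ a₂ a₃ b₁ b₂ b₃}
        (p₁ : InList G H L x a₁) (p₂ : InList G H L x a₂) (p₃ : InList G H L x a₃)
        (q₁ : InList G H L y b₁) (q₂ : InList G H L y b₂) (q₃ : InList G H L y b₃) →
        Step G δ x y → Step H δ a₁ b₁ → Step H δ a₂ b₂ → Step H δ a₃ b₃ →
        Step H δ (h x a₁ a₂ a₃ p₁ p₂ p₃) (h y b₁ b₂ b₃ q₁ q₂ q₃)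
      Step-preserved fwd p₁ p₂ p₃ q₁ q₂ q₃ =
        proj₂ hom _ _ _ _ _ _ _ _ p₁ p₂ p₃ q₁ q₂ q₃
      Step-preserved bwd p₁ p₂ p₃ q₁ q₂ q₃ =
        proj₂ hom _ _ _ _ _ _ _ _ q₁ q₂ q₃ p₁ p₂ p₃

      pointwise-IsWalk : ∀ {n} (ps : Vec Dir n) (xs : Vec (V G) (suc n)) (B C D : Vec (V H) (suc n))
        (pB : InLists G H L xs B) (pC : InLists G H L xs C) (pD : InLists G H L xs D) →
        IsWalk G ps xs → IsWalk H ps B → IsWalk H ps C → IsWalk H ps D →
        IsWalk H ps (pointwise xs B C D pB pC pD)
      pointwise-IsWalk [] (x ∷ []) (b ∷ []) (c ∷ []) (d ∷ []) _ _ _ _ _ _ _ = tt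
      pointwise-IsWalk (δ ∷ ps) (x ∷ y ∷ xs) (b ∷ b′ ∷ B) (c ∷ c′ ∷ C) (d ∷ d′ ∷ D) pB pC pD
        (g , wX) (s₁ , wB) (s₂ , wC) (s₃ , wD) =
        Step-preserved δ _ _ _ _ _ _ g s₁ s₂ s₃ ,
        pointwise-IsWalk ps (y ∷ xs) (b′ ∷ B) (c′ ∷ C) (d′ ∷ D)
          (InLists-tail pB) (InLists-tail pC) (InLists-tail pD) wX wB wC wD

    module _ (maltsev : IsMaltsev G H L h) where

      maltsevˡ : ∀ x a b (pa : InList G H L x a) (pb pb′ : InList G H L x b) →
        h x a b b pa pb pb′ ≡ a
      maltsevˡ x a b pa pb pb′ rewrite InList-irrelevant pb′ pb =
        proj₁ (maltsev x a b pa pb)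

      maltsevʳ : ∀ x a b (pb pb′ : InList G H L x b) (pa : InList G H L x a) →
        h x b b a pb pb′ pa ≡ a
      maltsevʳ x a b pb pb′ pa rewrite InList-irrelevant pb′ pb =
        proj₂ (maltsev x a b pa pb)

      head-pointwise : ∀ {n} (xs : Vec (V G) (suc n)) (B C D : Vec (V H) (suc n))
        (pB : InLists G H L xs B) (pC : InLists G H L xs C) (pD : InLists G H L xs D) →
        head C ≡ head D → head (pointwise xs B C D pB pC pD) ≡ head B
      head-pointwise (x ∷ xs) (b ∷ B) (c ∷ C) (.c ∷ D) pB pC pD refl =
        maltsevˡ x b c (pB zero) (pC zero) (pD zero)

      last-pointwise : ∀ {n} (xs : Vec (V G) (suc n)) (B C D : Vec (V H) (suc n))
        (pB : InLists G H L xs B) (pC : InLists G H L xs C) (pD : InLists G H L xs D) →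
        last B ≡ last C → last (pointwise xs B C D pB pC pD) ≡ last D
      last-pointwise (x ∷ []) (b ∷ []) (.b ∷ []) (d ∷ []) pB pC pD refl =
        maltsevʳ x d b (pB zero) (pC zero) (pD zero)
      last-pointwise (x ∷ y ∷ xs) (b ∷ B) (c ∷ C) (d ∷ D) pB pC pD eq =
        last-pointwise (y ∷ xs) B C D _ _ _ eq

lemma6 : (G H : Digraph) (L : Lists G H) (h : Ternary G H L) →
    IsConsistentHom G H L h → IsMaltsev G H L h →
    {n : ℕ} (ps : Vec Dir n) (xs : Vec (V G) (suc n)) → IsOrientedPath G ps xs →
    (a b c d : V H) (B C D : Vec (V H) (suc n)) →
    WalkInL G H L ps xs B → head B ≡ a → last B ≡ c →
    WalkInL G H L ps xs C → head C ≡ b → last C ≡ c →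
    WalkInL G H L ps xs D → head D ≡ b → last D ≡ d →
    Σ (Vec (V H) (suc n)) (λ E → WalkInL G H L ps xs E × head E ≡ a × last E ≡ d)
lemma6 G H L h hom maltsev {n} ps xs (walkX , _) a b c d B C D
  (walkB , inB) headB lastB (walkC , inC) headC lastC (walkD , inD) headD lastD =
  E ,
  (pointwise-IsWalk h hom ps xs B C D inB inC inD walkX walkB walkC walkD ,
   pointwise-InLists h hom xs B C D inB inC inD) ,
  trans (head-pointwise h maltsev xs B C D inB inC inD (trans headC (sym headD))) headB ,
  trans (last-pointwise h maltsev xs B C D inB inC inD (trans lastB (sym lastC))) lastD
  where
    E : Vec (V H) (suc n)
    E = pointwise h xs B C D inB inC inD
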